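{- Let $(P,\mathcal{L})$ be a linear system with $\Delta(P,\mathcal{L})=2$. Let $A\subseteq P$ be a set of maximum cardinality such that every point of $A$ has degree $2$ and no two points of $A$ lie on a common line, and let $\mathcal{L}'=\mathcal{L}\setminus\bigcup_{p\in A}\mathcal{L}_p$ be the set of lines containing no point of $A$. If $|\mathcal{L}'|\leq 1$, then $\tau(P,\mathcal{L})=\lceil \nu_2(P,\mathcal{L})/2\rceil$. Moreover, if $|\mathcal{L}'|=\nu_2(P,\mathcal{L})-2$, then $\tau(P,\mathcal{L})=\nu_2(P,\mathcal{L})-1$.
   Context: A linear system is a pair $(P,\mathcal{L})$ where $P$ is a finite set (points) and $\mathcal{L}$ is a family of subsets of $P$ (lines) such that $|l\cap l'|\leq 1$ for all distinct $l,l'\in\mathcal{L}$. For $p\in P$, $\mathcal{L}_p$ is the set of lines containing $p$ and $\deg(p)=|\mathcal{L}_p|$; $\Delta(P,\mathcal{L})$ is the maximum degree. A transversal is a set $T\subseteq P$ meeting every line; $\tau(P,\mathcal{L})$ is the minimum size of a transversal. A 2-packing is a set $R\subseteq\mathcal{L}$ such that no three lines of $R$ have a common point; $\nu_2(P,\mathcal{L})$ is the maximum size of a 2-packing. -}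

module Defs where

open import Data.Nat using (ℕ; _≤_; _≡ᵇ_)
open import Data.Bool using (Bool; if_then_else_)
open import Data.Fin using (Fin)
open import Data.Fin.Subset using (Subset; _∈_; _∩_; ∣_∣; Nonempty)
open import Data.Vec using (tabulate; lookup)
open import Data.Product using (∃; _×_)
open import Relation.Binary.PropositionalEquality using (_≡_; _≢_)
open import Relation.Nullary using (¬_)
open import Function.Definitions using (Injective)

Lines : ℕ → ℕ → Set
Lines n m = Fin m → Subset n

IsLinearSystem : ∀ {n m} → Lines n m → Set
IsLinearSystem {n} {m} L =
  Injective _≡_ _≡_ L × (∀ (i j : Fin m) → i ≢ j → ∣ L i ∩ L j ∣ ≤ 1)

linesAt : ∀ {n m} → Lines n m → Fin n → Subset m
linesAt L p = tabulate (λ i → lookup (L i) p)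

deg : ∀ {n m} → Lines n m → Fin n → ℕ
deg L p = ∣ linesAt L p ∣

MaxDegreeIs : ∀ {n m} → Lines n m → ℕ → Set
MaxDegreeIs {n} L d = (∀ (p : Fin n) → deg L p ≤ d) × ∃ (λ p → deg L p ≡ d)

IsTransversal : ∀ {n m} → Lines n m → Subset n → Set
IsTransversal {n} {m} L T = ∀ (i : Fin m) → Nonempty (T ∩ L i)

TauIs : ∀ {n m} → Lines n m → ℕ → Set
TauIs {n} L t =
  ∃ (λ T → IsTransversal L T × ∣ T ∣ ≡ t)
  × (∀ (T : Subset n) → IsTransversal L T → t ≤ ∣ T ∣)

-- R is a 2-packing: no three lines of R share a point, i.e. every point
-- lies on at most two lines of R.
Is2Packing : ∀ {n m} → Lines n m → Subset m → Set
Is2Packing {n} L R = ∀ (p : Fin n) → ∣ R ∩ linesAt L p ∣ ≤ 2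

Nu2Is : ∀ {n m} → Lines n m → ℕ → Set
Nu2Is {n} {m} L k =
  ∃ (λ R → Is2Packing L R × ∣ R ∣ ≡ k)
  × (∀ (R : Subset m) → Is2Packing L R → ∣ R ∣ ≤ k)

IsDeg2Independent : ∀ {n m} → Lines n m → Subset n → Set
IsDeg2Independent {n} {m} L A =
  (∀ (p : Fin n) → p ∈ A → deg L p ≡ 2)
  × (∀ (p q : Fin n) → p ∈ A → q ∈ A → p ≢ q →
       ¬ ∃ (λ (i : Fin m) → p ∈ L i × q ∈ L i))

IsMaxDeg2Independent : ∀ {n m} → Lines n m → Subset n → Set
IsMaxDeg2Independent {n} L A =
  IsDeg2Independent L A × (∀ (B : Subset n) → IsDeg2Independent L B → ∣ B ∣ ≤ ∣ A ∣)

linesAvoiding : ∀ {n m} → Lines n m → Subset n → Subset m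
linesAvoiding L A = tabulate (λ i → ∣ L i ∩ A ∣ ≡ᵇ 0)

-- Since every point has degree at most 2, the whole family of lines is a 2-packing, so
-- ν₂ = m is the number of lines; write a = |A| and ℓ = |L'|.  Three estimates squeeze τ:
--  * A together with one point on each line of L' is a transversal, so τ ≤ a + ℓ;
--  * every line meets A at most once and each point of A lies on two lines, so counting
--    incidences gives 2a + ℓ ≤ m;
--  * assign each line a point of a minimum transversal T lying on it: a point receives at
--    most two lines, and the points receiving two form a set of degree-2 points, no two
--    on a common line, so m ≤ |T| + a.
-- Hence τ = a + ℓ and m = 2a + ℓ, from which both claims are arithmetic.
module Submission where

open import Defs
open import Data.Nat using (ℕ; _≤_; _+_; ⌈_/2⌉)
open import Data.Fin using (Fin)
open import Data.Fin.Subset using (Subset; ∣_∣; Nonempty)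
open import Data.Product using (_×_)
open import Relation.Binary.PropositionalEquality using (_≡_)

open import Data.Nat.Properties using (+-0-commutativeMonoid)
open import Algebra.Properties.CommutativeMonoid.Sum +-0-commutativeMonoid
  using (sum-syntax; sum-cong-≗; ∑-comm; ∑-distrib-+)
open import Data.Bool using (Bool; true; false; T; if_then_else_)
open import Data.Bool.Properties using (T-≡)
open import Data.Empty using (⊥-elim)
open import Data.Fin using (zero; suc; _≟_)
open import Data.Fin.Subset using (_∈_; _∉_; _∩_; _∪_; _⊆_; ⊥; ⊤; ⁅_⁆; Empty)
open import Data.Fin.Subset.Properties
  using (_∈?_; nonempty?; Empty-unique; ∣⊥∣≡0; ∣⊤∣≡n; ∣p∣≤n; ∣⁅x⁆∣≡1; x∈⁅x⁆; x∈⁅y⁆⇒x≡y;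
         x∈p∩q⁺; x∈p∩q⁻; p⊆p∪q; q⊆p∪q; p⊆q⇒∣p∣≤∣q∣; p⊂q⇒∣p∣<∣q∣; ∩-identityˡ)
open import Data.Nat using (zero; suc; z≤n; s≤s; _∸_; _≤ᵇ_)
open import Data.Nat.Properties
  using (≤-refl; ≤-trans; ≤-antisym; ≤-reflexive; ≤-pred; ≰⇒>; <⇒≱; n≤1+n;
         +-mono-≤; +-monoˡ-≤; +-monoʳ-≤; +-comm; +-assoc; +-suc; +-identityʳ; +-cancelˡ-≤; +-cancelʳ-≡;
         ≡ᵇ⇒≡; ≡⇒≡ᵇ; ≤ᵇ⇒≤; ≤⇒≤ᵇ; n≡⌊n+n/2⌋; n≡⌈n+n/2⌉; module ≤-Reasoning)
open import Data.Product using (∃-syntax; _,_; proj₁; proj₂)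
open import Data.Vec using ([]; _∷_; lookup; tabulate; there)
open import Data.Vec.Properties using (lookup∘tabulate; []=⇒lookup; lookup⇒[]=)
open import Function.Bundles using (Equivalence)
open import Relation.Binary.PropositionalEquality using (refl; sym; trans; cong; cong₂; subst; module ≡-Reasoning)
open import Relation.Nullary using (yes; no; decidable-stable)

open Equivalence using (to; from)

∈-tabulate⁺ : ∀ {k} {f : Fin k → Bool} {i} → f i ≡ true → i ∈ tabulate f
∈-tabulate⁺ {f = f} {i} fi = lookup⇒[]= i (tabulate f) (trans (lookup∘tabulate f i) fi)

∈-tabulate⁻ : ∀ {k} {f : Fin k → Bool} {i} → i ∈ tabulate f → f i ≡ true
∈-tabulate⁻ {f = f} {i} i∈ = trans (sym (lookup∘tabulate f i)) ([]=⇒lookup i∈)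

Empty⇒∣p∣≡0 : ∀ {k} {S : Subset k} → Empty S → ∣ S ∣ ≡ 0
Empty⇒∣p∣≡0 {k} e = trans (cong ∣_∣ (Empty-unique e)) (∣⊥∣≡0 k)

∣p∣≤1 : ∀ {k} (S : Subset k) → (∀ {x y} → x ∈ S → y ∈ S → x ≡ y) → ∣ S ∣ ≤ 1
∣p∣≤1 S unique with nonempty? S
... | no  S-empty  = ≤-trans (≤-reflexive (Empty⇒∣p∣≡0 S-empty)) z≤n
... | yes (x , x∈S) = ≤-trans (p⊆q⇒∣p∣≤∣q∣ S⊆⁅x⁆) (≤-reflexive (∣⁅x⁆∣≡1 x))
  where
  S⊆⁅x⁆ : S ⊆ ⁅ x ⁆
  S⊆⁅x⁆ y∈S = subst (_∈ ⁅ x ⁆) (unique x∈S y∈S) (x∈⁅x⁆ x)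

p⊆q∧∣q∣≤∣p∣⇒q⊆p : ∀ {k} {S U : Subset k} → S ⊆ U → ∣ U ∣ ≤ ∣ S ∣ → U ⊆ S
p⊆q∧∣q∣≤∣p∣⇒q⊆p {S = S} S⊆U ∣U∣≤∣S∣ {x} x∈U with x ∈? S
... | yes x∈S = x∈S
... | no  x∉S = ⊥-elim (<⇒≱ (p⊂q⇒∣p∣<∣q∣ (S⊆U , x , x∈U , x∉S)) ∣U∣≤∣S∣)

∣p∪q∣≤∣p∣+∣q∣ : ∀ {k} (S U : Subset k) → ∣ S ∪ U ∣ ≤ ∣ S ∣ + ∣ U ∣
∣p∪q∣≤∣p∣+∣q∣ []          []          = z≤n
∣p∪q∣≤∣p∣+∣q∣ (true  ∷ S) (true  ∷ U) = s≤s (≤-trans (∣p∪q∣≤∣p∣+∣q∣ S U) (+-monoʳ-≤ ∣ S ∣ (n≤1+n ∣ U ∣)))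
∣p∪q∣≤∣p∣+∣q∣ (true  ∷ S) (false ∷ U) = s≤s (∣p∪q∣≤∣p∣+∣q∣ S U)
∣p∪q∣≤∣p∣+∣q∣ (false ∷ S) (true  ∷ U) = ≤-trans (s≤s (∣p∪q∣≤∣p∣+∣q∣ S U)) (≤-reflexive (sym (+-suc ∣ S ∣ ∣ U ∣)))
∣p∪q∣≤∣p∣+∣q∣ (false ∷ S) (false ∷ U) = ∣p∪q∣≤∣p∣+∣q∣ S U

image : ∀ {k n} → (Fin k → Fin n) → Subset k → Subset n
image c []          = ⊥
image c (true  ∷ S) = ⁅ c zero ⁆ ∪ image (λ i → c (suc i)) S
image c (false ∷ S) = image (λ i → c (suc i)) S

∣image∣≤∣p∣ : ∀ {k n} (c : Fin k → Fin n) (S : Subset k) → ∣ image c S ∣ ≤ ∣ S ∣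
∣image∣≤∣p∣ {n = n} c []  = ≤-reflexive (∣⊥∣≡0 n)
∣image∣≤∣p∣ c (true ∷ S) = ≤-trans (∣p∪q∣≤∣p∣+∣q∣ ⁅ c zero ⁆ _)
  (≤-trans (≤-reflexive (cong (_+ ∣ image (λ i → c (suc i)) S ∣) (∣⁅x⁆∣≡1 (c zero)))) (s≤s (∣image∣≤∣p∣ (λ i → c (suc i)) S)))
∣image∣≤∣p∣ c (false ∷ S) = ∣image∣≤∣p∣ (λ i → c (suc i)) S

∈-image⁺ : ∀ {k n} (c : Fin k → Fin n) (S : Subset k) {i} → i ∈ S → c i ∈ image c S
∈-image⁺ c (true ∷ S) {zero}  _           = p⊆p∪q _ (x∈⁅x⁆ (c zero))
∈-image⁺ c (true ∷ S) {suc i} (there i∈S) = q⊆p∪q ⁅ c zero ⁆ _ (∈-image⁺ (λ j → c (suc j)) S i∈S)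
∈-image⁺ c (false ∷ S) {suc i} (there i∈S) = ∈-image⁺ (λ j → c (suc j)) S i∈S

indicator : ∀ {k} → Subset k → Fin k → ℕ
indicator S i = if lookup S i then 1 else 0

indicator-∈ : ∀ {k} {S : Subset k} {i} → i ∈ S → indicator S i ≡ 1
indicator-∈ {i = i} i∈S rewrite []=⇒lookup i∈S = refl

indicator-∉ : ∀ {k} {S : Subset k} {i} → i ∉ S → indicator S i ≡ 0
indicator-∉ {S = S} {i} i∉S with lookup S i in eq
... | true  = ⊥-elim (i∉S (lookup⇒[]= i S eq))
... | false = refl

∣p∣≡∑indicator : ∀ {k} (S : Subset k) → ∣ S ∣ ≡ ∑[ i < k ] indicator S i
∣p∣≡∑indicator []          = refl
∣p∣≡∑indicator (true  ∷ S) = cong suc (∣p∣≡∑indicator S)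
∣p∣≡∑indicator (false ∷ S) = ∣p∣≡∑indicator S

∑-mono-≤ : ∀ {k} {f g : Fin k → ℕ} → (∀ i → f i ≤ g i) → ∑[ i < k ] f i ≤ ∑[ i < k ] g i
∑-mono-≤ {zero}  f≤g = z≤n
∑-mono-≤ {suc k} f≤g = +-mono-≤ (f≤g zero) (∑-mono-≤ (λ i → f≤g (suc i)))

∑-1≡n : ∀ k → ∑[ i < k ] 1 ≡ k
∑-1≡n zero    = refl
∑-1≡n (suc k) = cong suc (∑-1≡n k)

∣p∣+∣q∣≡∑indicator : ∀ {k} (S U : Subset k) →
  ∣ S ∣ + ∣ U ∣ ≡ ∑[ i < k ] (indicator S i + indicator U i)
∣p∣+∣q∣≡∑indicator S U =
  trans (cong₂ _+_ (∣p∣≡∑indicator S) (∣p∣≡∑indicator U)) (sym (∑-distrib-+ (indicator S) (indicator U)))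

module _ {n m} (L : Lines n m) where

  ∈-linesAt⁺ : ∀ {p i} → p ∈ L i → i ∈ linesAt L p
  ∈-linesAt⁺ p∈Li = ∈-tabulate⁺ ([]=⇒lookup p∈Li)

  ∈-linesAt⁻ : ∀ {p i} → i ∈ linesAt L p → p ∈ L i
  ∈-linesAt⁻ {p} {i} i∈Lp = lookup⇒[]= p (L i) (∈-tabulate⁻ i∈Lp)

  ∑∣line∣≡∑deg : ∑[ i < m ] ∣ L i ∣ ≡ ∑[ p < n ] deg L p
  ∑∣line∣≡∑deg = begin
    ∑[ i < m ] ∣ L i ∣                       ≡⟨ sum-cong-≗ (λ i → ∣p∣≡∑indicator (L i)) ⟩
    ∑[ i < m ] ∑[ p < n ] indicator (L i) p  ≡⟨ ∑-comm (λ i p → indicator (L i) p) ⟩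
    ∑[ p < n ] ∑[ i < m ] indicator (L i) p  ≡⟨ sum-cong-≗ (λ p → sym (deg≡∑indicator p)) ⟩
    ∑[ p < n ] deg L p                       ∎
    where
    open ≡-Reasoning
    deg≡∑indicator : ∀ p → deg L p ≡ ∑[ i < m ] indicator (L i) p
    deg≡∑indicator p = trans (∣p∣≡∑indicator (linesAt L p))
      (sum-cong-≗ (λ i → cong (if_then 1 else 0) (lookup∘tabulate (λ j → lookup (L j) p) i)))

  ∈-linesAvoiding⁺ : ∀ {A i} → ∣ L i ∩ A ∣ ≡ 0 → i ∈ linesAvoiding L A
  ∈-linesAvoiding⁺ {i = i} empty = ∈-tabulate⁺ (to T-≡ (≡⇒≡ᵇ ∣ L i ∩ _ ∣ 0 empty))

  ∈-linesAvoiding⁻ : ∀ {A i} → i ∈ linesAvoiding L A → ∣ L i ∩ A ∣ ≡ 0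
  ∈-linesAvoiding⁻ {i = i} i∈L' = ≡ᵇ⇒≡ ∣ L i ∩ _ ∣ 0 (from T-≡ (∈-tabulate⁻ i∈L'))

linesAt-mono : ∀ {n m} {M L : Lines n m} → (∀ i → M i ⊆ L i) → ∀ p → linesAt M p ⊆ linesAt L p
linesAt-mono {M = M} {L} M⊆L p i∈Mp = ∈-linesAt⁺ L (M⊆L _ (∈-linesAt⁻ M i∈Mp))

ν₂≡#lines : ∀ {n m} (L : Lines n m) {k} → (∀ p → deg L p ≤ 2) → Nu2Is L k → k ≡ m
ν₂≡#lines {n} {m} L Δ≤2 ((R , _ , ∣R∣≡k) , maximal) =
  ≤-antisym (subst (_≤ m) ∣R∣≡k (∣p∣≤n R)) (subst (_≤ _) (∣⊤∣≡n m) (maximal ⊤ allLines-2Packing))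
  where
  allLines-2Packing : Is2Packing L ⊤
  allLines-2Packing p = subst (_≤ 2) (sym (cong ∣_∣ (∩-identityˡ (linesAt L p)))) (Δ≤2 p)

extend-to-transversal : ∀ {n m} (L : Lines n m) → (∀ i → Nonempty (L i)) → ∀ A →
  ∃[ T ] IsTransversal L T × ∣ T ∣ ≤ ∣ A ∣ + ∣ linesAvoiding L A ∣
extend-to-transversal {n} {m} L nonempty A =
  A ∪ image c L' , covers , ≤-trans (∣p∪q∣≤∣p∣+∣q∣ A _) (+-monoʳ-≤ ∣ A ∣ (∣image∣≤∣p∣ c L'))
  where
  L' : Subset m
  L' = linesAvoiding L A
  c : Fin m → Fin n
  c i = proj₁ (nonempty i)
  covers : IsTransversal L (A ∪ image c L')
  covers i with i ∈? L'
  ... | yes i∈L' = c i , x∈p∩q⁺ (q⊆p∪q A _ (∈-image⁺ c L' i∈L') , proj₂ (nonempty i))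
  ... | no  i∉L' with nonempty? (L i ∩ A)
  ...   | yes (x , x∈Li∩A) = x , x∈p∩q⁺ (p⊆p∪q _ (proj₂ (x∈p∩q⁻ (L i) A x∈Li∩A)) , proj₁ (x∈p∩q⁻ (L i) A x∈Li∩A))
  ...   | no  Li∩A-empty   = ⊥-elim (i∉L' (∈-linesAvoiding⁺ L (Empty⇒∣p∣≡0 Li∩A-empty)))

module _ {n m} (L : Lines n m) {A : Subset n} (A-indep : IsDeg2Independent L A) where

  ∣line∩A∣≤1 : ∀ i → ∣ L i ∩ A ∣ ≤ 1
  ∣line∩A∣≤1 i = ∣p∣≤1 (L i ∩ A) λ {x} {y} x∈ y∈ → decidable-stable (x ≟ y) λ x≢y →
    let x∈Li , x∈A = x∈p∩q⁻ (L i) A x∈ ; y∈Li , y∈A = x∈p∩q⁻ (L i) A y∈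
    in proj₂ A-indep x y x∈A y∈A x≢y (i , x∈Li , y∈Li)

  ∣line∩A∣+indicator≤1 : ∀ i → ∣ L i ∩ A ∣ + indicator (linesAvoiding L A) i ≤ 1
  ∣line∩A∣+indicator≤1 i with i ∈? linesAvoiding L A
  ... | yes i∈L' rewrite ∈-linesAvoiding⁻ L i∈L' | indicator-∈ i∈L' = ≤-refl
  ... | no  i∉L' rewrite indicator-∉ i∉L' | +-identityʳ ∣ L i ∩ A ∣ = ∣line∩A∣≤1 i

  2·indicator≤deg∩A : ∀ p → indicator A p + indicator A p ≤ deg (λ i → L i ∩ A) p
  2·indicator≤deg∩A p with p ∈? A
  ... | yes p∈A rewrite indicator-∈ p∈A = subst (_≤ deg (λ i → L i ∩ A) p) (proj₁ A-indep p p∈A)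
        (p⊆q⇒∣p∣≤∣q∣ (λ i∈Lp → ∈-linesAt⁺ (λ i → L i ∩ A) (x∈p∩q⁺ (∈-linesAt⁻ L i∈Lp , p∈A))))
  ... | no  p∉A rewrite indicator-∉ p∉A = z≤n

  ∣A∣+∣A∣+∣linesAvoiding∣≤#lines : ∣ A ∣ + ∣ A ∣ + ∣ linesAvoiding L A ∣ ≤ m
  ∣A∣+∣A∣+∣linesAvoiding∣≤#lines = begin
    ∣ A ∣ + ∣ A ∣ + ∣ L' ∣                          ≡⟨ cong (_+ ∣ L' ∣) (∣p∣+∣q∣≡∑indicator A A) ⟩
    ∑[ p < n ] (indicator A p + indicator A p) + ∣ L' ∣ ≤⟨ +-monoˡ-≤ ∣ L' ∣ (∑-mono-≤ 2·indicator≤deg∩A) ⟩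
    ∑[ p < n ] deg (λ i → L i ∩ A) p + ∣ L' ∣        ≡⟨ cong₂ _+_ (sym (∑∣line∣≡∑deg (λ i → L i ∩ A))) (∣p∣≡∑indicator L') ⟩
    ∑[ i < m ] ∣ L i ∩ A ∣ + ∑[ i < m ] indicator L' i ≡⟨ sym (∑-distrib-+ (λ i → ∣ L i ∩ A ∣) (indicator L')) ⟩
    ∑[ i < m ] (∣ L i ∩ A ∣ + indicator L' i)        ≤⟨ ∑-mono-≤ ∣line∩A∣+indicator≤1 ⟩
    ∑[ i < m ] 1                                     ≡⟨ ∑-1≡n m ⟩
    m                                                ∎
    where
    open ≤-Reasoning
    L' : Subset m
    L' = linesAvoiding L A

module AssignedLines {n m} (L : Lines n m) (Δ≤2 : ∀ p → deg L p ≤ 2) (T : Subset n)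
                     (c : Fin m → Fin n) (c∈T : ∀ i → c i ∈ T) (c∈L : ∀ i → c i ∈ L i) where

  assigned : Lines n m
  assigned i = ⁅ c i ⁆

  assigned⇒≡ : ∀ {p i} → i ∈ linesAt assigned p → p ≡ c i
  assigned⇒≡ i∈ = x∈⁅y⁆⇒x≡y _ (∈-linesAt⁻ assigned i∈)

  assigned⊆linesAt : ∀ p → linesAt assigned p ⊆ linesAt L p
  assigned⊆linesAt = linesAt-mono λ i x∈⁅ci⁆ → subst (_∈ L i) (sym (x∈⁅y⁆⇒x≡y _ x∈⁅ci⁆)) (c∈L i)

  ∑deg-assigned≡#lines : ∑[ p < n ] deg assigned p ≡ m
  ∑deg-assigned≡#lines =
    trans (sym (∑∣line∣≡∑deg assigned)) (trans (sum-cong-≗ (λ i → ∣⁅x⁆∣≡1 (c i))) (∑-1≡n m))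

  doubly : Subset n
  doubly = tabulate (λ p → 2 ≤ᵇ deg assigned p)

  ∈-doubly⁺ : ∀ {p} → 2 ≤ deg assigned p → p ∈ doubly
  ∈-doubly⁺ 2≤ = ∈-tabulate⁺ (to T-≡ (≤⇒≤ᵇ 2≤))

  ∈-doubly⁻ : ∀ {p} → p ∈ doubly → 2 ≤ deg assigned p
  ∈-doubly⁻ p∈ = ≤ᵇ⇒≤ 2 _ (from T-≡ (∈-tabulate⁻ p∈))

  -- p is assigned at least deg p lines, all of them through p.
  doubly-receives-its-lines : ∀ {p i} → p ∈ doubly → p ∈ L i → c i ≡ p
  doubly-receives-its-lines {p} p∈ p∈Li = sym (assigned⇒≡
    (p⊆q∧∣q∣≤∣p∣⇒q⊆p (assigned⊆linesAt p) (≤-trans (Δ≤2 p) (∈-doubly⁻ p∈)) (∈-linesAt⁺ L p∈Li)))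

  doubly-independent : IsDeg2Independent L doubly
  doubly-independent =
    (λ p p∈ → ≤-antisym (Δ≤2 p) (≤-trans (∈-doubly⁻ p∈) (p⊆q⇒∣p∣≤∣q∣ (assigned⊆linesAt p)))) ,
    λ p q p∈ q∈ p≢q (i , p∈Li , q∈Li) →
      p≢q (trans (sym (doubly-receives-its-lines p∈ p∈Li)) (doubly-receives-its-lines q∈ q∈Li))

  deg-assigned≤indicators : ∀ p → deg assigned p ≤ indicator doubly p + indicator T p
  deg-assigned≤indicators p with p ∈? T | p ∈? doubly
  ... | no  p∉T | _ = ≤-trans (≤-reflexive (Empty⇒∣p∣≡0 λ (i , i∈) →
                        p∉T (subst (_∈ T) (sym (assigned⇒≡ i∈)) (c∈T i)))) z≤n
  ... | yes p∈T | yes p∈D rewrite indicator-∈ p∈T | indicator-∈ p∈D =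
                        ≤-trans (p⊆q⇒∣p∣≤∣q∣ (assigned⊆linesAt p)) (Δ≤2 p)
  ... | yes p∈T | no  p∉D rewrite indicator-∈ p∈T | indicator-∉ p∉D =
                        ≤-pred (≰⇒> λ 2≤ → p∉D (∈-doubly⁺ 2≤))

  #lines≤∣doubly∣+∣T∣ : m ≤ ∣ doubly ∣ + ∣ T ∣
  #lines≤∣doubly∣+∣T∣ = begin
    m                                                 ≡⟨ sym ∑deg-assigned≡#lines ⟩
    ∑[ p < n ] deg assigned p                         ≤⟨ ∑-mono-≤ deg-assigned≤indicators ⟩
    ∑[ p < n ] (indicator doubly p + indicator T p)   ≡⟨ sym (∣p∣+∣q∣≡∑indicator doubly T) ⟩
    ∣ doubly ∣ + ∣ T ∣                                ∎
    where open ≤-Reasoning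

#lines≤∣independent∣+∣transversal∣ : ∀ {n m} (L : Lines n m) → (∀ p → deg L p ≤ 2) →
  ∀ T → IsTransversal L T → ∃[ B ] IsDeg2Independent L B × m ≤ ∣ B ∣ + ∣ T ∣
#lines≤∣independent∣+∣transversal∣ {n} {m} L Δ≤2 T T-meets =
  doubly , doubly-independent , #lines≤∣doubly∣+∣T∣
  where
  c : Fin m → Fin n
  c i = proj₁ (T-meets i)
  open AssignedLines L Δ≤2 T c (λ i → proj₁ (x∈p∩q⁻ T (L i) (proj₂ (T-meets i))))
                               (λ i → proj₂ (x∈p∩q⁻ T (L i) (proj₂ (T-meets i))))

squeeze : ∀ {a ℓ t m} → m ≤ a + t → t ≤ a + ℓ → a + a + ℓ ≤ m → t ≡ a + ℓ × m ≡ a + a + ℓ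
squeeze {a} {ℓ} {t} m≤a+t t≤a+ℓ 2a+ℓ≤m =
  ≤-antisym t≤a+ℓ (+-cancelˡ-≤ a _ _ (≤-trans (≤-reflexive (sym (+-assoc a a ℓ))) (≤-trans 2a+ℓ≤m m≤a+t))) ,
  ≤-antisym (≤-trans m≤a+t (≤-trans (+-monoʳ-≤ a t≤a+ℓ) (≤-reflexive (sym (+-assoc a a ℓ))))) 2a+ℓ≤m

⌈a+a+ℓ/2⌉≡a+ℓ : ∀ a {ℓ} → ℓ ≤ 1 → ⌈ a + a + ℓ /2⌉ ≡ a + ℓ
⌈a+a+ℓ/2⌉≡a+ℓ a z≤n rewrite +-identityʳ (a + a) | +-identityʳ a = sym (n≡⌈n+n/2⌉ a)
⌈a+a+ℓ/2⌉≡a+ℓ a (s≤s z≤n) rewrite +-comm (a + a) 1 | +-comm a 1 = cong suc (sym (n≡⌊n+n/2⌋ a))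

a+a≡2⇒a≡1 : ∀ a → a + a ≡ 2 → a ≡ 1
a+a≡2⇒a≡1 (suc zero)    _  = refl
a+a≡2⇒a≡1 (suc (suc a)) eq with trans (sym (+-suc a (suc a))) (cong (_∸ 2) eq)
... | ()

a+a+ℓ≡ℓ+2⇒a+ℓ+1≡ℓ+2 : ∀ a ℓ → a + a + ℓ ≡ ℓ + 2 → a + ℓ + 1 ≡ ℓ + 2
a+a+ℓ≡ℓ+2⇒a+ℓ+1≡ℓ+2 a ℓ eq with a+a≡2⇒a≡1 a (+-cancelʳ-≡ ℓ (a + a) 2 (trans eq (+-comm ℓ 2)))
... | refl = sym (+-suc ℓ 1)

corollary2p2 : ∀ (n m : ℕ) (L : Lines n m) →
    IsLinearSystem L →
    (∀ (i : Fin m) → Nonempty (L i)) →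
    MaxDegreeIs L 2 →
    ∀ (A : Subset n) → IsMaxDeg2Independent L A →
    ∀ (t k : ℕ) → TauIs L t → Nu2Is L k →
    (∣ linesAvoiding L A ∣ ≤ 1 → t ≡ ⌈ k /2⌉)
    × (∣ linesAvoiding L A ∣ + 2 ≡ k → t + 1 ≡ k)
corollary2p2 n m L _ nonempty (Δ≤2 , _) A (A-indep , A-max) t k ((T , T-meets , ∣T∣≡t) , τ-min) ν₂-is-k =
  (λ ℓ≤1 → trans t≡a+ℓ (sym (trans (cong ⌈_/2⌉ k≡a+a+ℓ) (⌈a+a+ℓ/2⌉≡a+ℓ a ℓ≤1)))) ,
  (λ ℓ+2≡k → trans (cong (_+ 1) t≡a+ℓ) (trans (a+a+ℓ≡ℓ+2⇒a+ℓ+1≡ℓ+2 a ℓ (trans (sym k≡a+a+ℓ) (sym ℓ+2≡k))) ℓ+2≡k))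
  where
  a ℓ : ℕ
  a = ∣ A ∣
  ℓ = ∣ linesAvoiding L A ∣
  m≤a+t : m ≤ a + t
  m≤a+t with #lines≤∣independent∣+∣transversal∣ L Δ≤2 T T-meets
  ... | B , B-indep , m≤B+T = ≤-trans m≤B+T (+-mono-≤ (A-max B B-indep) (≤-reflexive ∣T∣≡t))
  t≤a+ℓ : t ≤ a + ℓ
  t≤a+ℓ with extend-to-transversal L nonempty A
  ... | T′ , T′-meets , ∣T′∣≤a+ℓ = ≤-trans (τ-min T′ T′-meets) ∣T′∣≤a+ℓ
  tight : t ≡ a + ℓ × m ≡ a + a + ℓ
  tight = squeeze m≤a+t t≤a+ℓ (∣A∣+∣A∣+∣linesAvoiding∣≤#lines L A-indep)
  t≡a+ℓ : t ≡ a + ℓ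
  t≡a+ℓ = proj₁ tight
  k≡a+a+ℓ : k ≡ a + a + ℓ
  k≡a+a+ℓ = trans (ν₂≡#lines L Δ≤2 ν₂-is-k) (proj₂ tight)
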